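{- Let $x,y,z$ be integers with $x>1$, $y,z\ge1$ and $y\ne z$. Then the $(0,x,y,z)$-hiccup sequence is morphic.
   Context: For $x\in\mathbb{Z}_{\ge0}$ and $y,z\in\mathbb{Z}_{\ge1}$ with $y\ne z$, the $(0,x,y,z)$-hiccup sequence is the integer sequence $(a(n))_{n\ge1}$ defined by $a(1)=x$ and, for $n\ge 2$, $a(n)=a(n-1)+y$ if $n\in\{a(k):1\le k<n\}$, and $a(n)=a(n-1)+z$ otherwise. The characteristic sequence of an increasing integer sequence $(a(n))$ is the binary sequence $(c(m))_{m\ge1}$ with $c(m)=1$ if $m=a(k)$ for some $k$ and $c(m)=0$ otherwise. A binary sequence $(c(m))_{m\ge1}$ is morphic if there exist a finite alphabet $\Sigma$, a morphism $\phi:\Sigma\to\Sigma^*$, a letter $s\in\Sigma$ such that $\phi(s)$ begins with $s$ and the lengths of $\phi^n(s)$ are unbounded (so $w=\phi^\infty(s)=w_1w_2\cdots$ is an infinite fixed point of $\phi$), and a letter-to-letter coding $\pi:\Sigma\to\{0,1\}$ with $c(m)=\pi(w_m)$ for all $m\ge1$. An increasing sequence is morphic if its characteristic sequence is morphic. -}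

module Defs where

open import Data.Nat using (ℕ; zero; suc; _+_; _≤_; _<_; _≟_)
open import Data.Bool using (Bool; true; false)
open import Data.Fin using (Fin; fromℕ<)
open import Data.List using (List; []; _∷_; length; lookup; concatMap)
open import Data.List.Membership.DecPropositional _≟_ using (_∈?_)
open import Data.Product using (Σ; ∃; _×_; _,_; proj₁)
open import Relation.Nullary using (yes; no)
open import Relation.Binary.PropositionalEquality using (_≡_)
open import Function.Bundles using (_⇔_)

-- hiccupAux x y z k = ( a(k+1) , [a(k+1), a(k), ..., a(1)] )
-- for the (0,x,y,z)-hiccup sequence a.
hiccupAux : ℕ → ℕ → ℕ → ℕ → ℕ × List ℕ
hiccupAux x y z zero = x , x ∷ []
hiccupAux x y z (suc k) with hiccupAux x y z k
... | last , prev with suc (suc k) ∈? prev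
...   | yes _ = last + y , (last + y) ∷ prev
...   | no _  = last + z , (last + z) ∷ prev

-- The (0,x,y,z)-hiccup sequence, 1-indexed: hiccup x y z n = a(n) for n ≥ 1.
-- The value at index 0 is junk (0) and is never used.
hiccup : ℕ → ℕ → ℕ → ℕ → ℕ
hiccup x y z zero    = 0
hiccup x y z (suc k) = proj₁ (hiccupAux x y z k)

IsCharSeq : (ℕ → ℕ) → (ℕ → Bool) → Set
IsCharSeq a c = ∀ m → 1 ≤ m → (c m ≡ true ⇔ (∃ λ k → 1 ≤ k × a k ≡ m))

iterMorph : ∀ {s} → (Fin s → List (Fin s)) → ℕ → List (Fin s) → List (Fin s)
iterMorph φ zero    u = u
iterMorph φ (suc n) u = concatMap φ (iterMorph φ n u)

-- A binary sequence c (1-indexed) is morphic: finite alphabet Fin s,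
-- morphism φ, letter st with φ(st) beginning with st, lengths of φ^n(st)
-- unbounded, w = φ^∞(st) (0-indexed infinite word: w agrees with every
-- φ^n(st) on its positions), and a coding π with c(m+1) = π(w_m).
IsMorphicBin : (ℕ → Bool) → Set
IsMorphicBin c =
  Σ ℕ λ s →
  Σ (Fin s → List (Fin s)) λ φ →
  Σ (Fin s) λ st →
  Σ (ℕ → Fin s) λ w →
  Σ (Fin s → Bool) λ π →
    (∃ λ rest → φ st ≡ st ∷ rest)
  × (∀ B → ∃ λ n → B < length (iterMorph φ n (st ∷ [])))
  × (∀ n i (p : i < length (iterMorph φ n (st ∷ []))) →
       w i ≡ lookup (iterMorph φ n (st ∷ [])) (fromℕ< p))
  × (∀ m → c (suc m) ≡ π (w m))

IsMorphicSeq : (ℕ → ℕ) → Set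
IsMorphicSeq a = Σ (ℕ → Bool) λ c → IsCharSeq a c × IsMorphicBin c

-- Let w be the infinite word over {s, 0, 1} with w₀ = s and wᵢ = c(i+1) for i ≥ 1,
-- where c is the characteristic sequence of the hiccup sequence a. The difference
-- a(n+1) − a(n) is y or z according as n+1 is a term of a, i.e. according to the
-- letter w_n; so the stretch of w encoding c(a(n)+1), …, c(a(n+1)) is 0^(y−1)1 or
-- 0^(z−1)1 as w_n is 1 or 0. Hence the image of w₀ ⋯ w_(n−1) under
-- s ↦ s0^(x−2)1, 0 ↦ 0^(z−1)1, 1 ↦ 0^(y−1)1 is the prefix of w of length a(n),
-- and w is the fixed point of this morphism started at s.
module Submission where

open import Defs
open import Data.Nat using (ℕ; _<_; _≤_)
open import Relation.Binary.PropositionalEquality using (_≢_)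

open import Data.Nat using (zero; suc; _+_; _∸_; _≤′_; z≤n; s≤s; _≟_; _≤?_)
open import Data.Nat.Properties
open import Data.Bool using (Bool; true; false)
open import Data.Fin using (Fin; fromℕ<) renaming (zero to fzero; suc to fsuc)
open import Data.Fin.Properties using (toℕ-fromℕ<)
open import Data.List using (List; []; _∷_; _++_; _∷ʳ_; length; lookup; concatMap; replicate; applyUpTo; applyDownFrom)
open import Data.List.Properties using (++-identityʳ; concatMap-++; applyUpTo-∷ʳ; length-applyUpTo; lookup-applyUpTo)
open import Data.List.Membership.Propositional using (_∈_)
open import Data.List.Membership.Propositional.Properties using (∈-applyDownFrom⁺; ∈-applyDownFrom⁻)
open import Data.List.Membership.DecPropositional _≟_ using (_∈?_)
open import Data.Product using (∃; _×_; _,_; proj₁; proj₂)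
open import Relation.Nullary using (¬_; Dec; yes; no; does; proof; Reflects; invert)
open import Relation.Nullary.Decidable using (map′; dec-true; dec-false)
open import Relation.Binary.PropositionalEquality using (_≡_; refl; sym; trans; cong; cong₂; subst; module ≡-Reasoning)
open import Function.Bundles using (mk⇔)

applyUpTo-++ : ∀ {A : Set} (f : ℕ → A) m n →
               applyUpTo f (m + n) ≡ applyUpTo f m ++ applyUpTo (λ i → f (m + i)) n
applyUpTo-++ f zero    n = refl
applyUpTo-++ f (suc m) n = cong (f 0 ∷_) (applyUpTo-++ (λ i → f (suc i)) m n)

applyUpTo≡replicate∷ʳ : ∀ {A : Set} (f : ℕ → A) {u v : A} g →
                        (∀ t → t < g → f t ≡ u) → f g ≡ v →
                        applyUpTo f (suc g) ≡ replicate g u ∷ʳ v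
applyUpTo≡replicate∷ʳ f zero    f<g fg = cong (_∷ []) fg
applyUpTo≡replicate∷ʳ f (suc g) f<g fg =
  cong₂ _∷_ (f<g 0 (s≤s z≤n))
            (applyUpTo≡replicate∷ʳ (λ i → f (suc i)) g (λ t t<g → f<g (suc t) (s≤s t<g)) fg)

module _ {s} (σ : Fin s → List (Fin s)) (w : ℕ → Fin s) (ℓ : ℕ → ℕ)
         (σ-prefix : ∀ n → concatMap σ (applyUpTo w (suc n)) ≡ applyUpTo w (ℓ n))
         (ℓ-expands : ∀ n → suc n < ℓ n) where

  iterMorph≡applyUpTo : ∀ n → ∃ λ N → n < N × iterMorph σ n (w 0 ∷ []) ≡ applyUpTo w N
  iterMorph≡applyUpTo zero = 1 , s≤s z≤n , refl
  iterMorph≡applyUpTo (suc n) with iterMorph≡applyUpTo n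
  ... | suc N , n<1+N , eq =
    ℓ N , <-≤-trans (s≤s n<1+N) (ℓ-expands N) , trans (cong (concatMap σ) eq) (σ-prefix N)

  σ-prolongable : ∃ λ rest → σ (w 0) ≡ w 0 ∷ rest
  σ-prolongable with ℓ 0 | ℓ-expands 0 | σ-prefix 0
  ... | suc k | _ | eq = applyUpTo (λ i → w (suc i)) k , trans (sym (++-identityʳ (σ (w 0)))) eq

  lookup-iterMorph : ∀ n i (p : i < length (iterMorph σ n (w 0 ∷ []))) →
                     w i ≡ lookup (iterMorph σ n (w 0 ∷ [])) (fromℕ< p)
  lookup-iterMorph n i p = agree (iterMorph σ n (w 0 ∷ [])) (proj₂ (proj₂ (iterMorph≡applyUpTo n))) p
    where
    agree : ∀ {N} us → us ≡ applyUpTo w N → (p : i < length us) → w i ≡ lookup us (fromℕ< p)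
    agree {N} _ refl p = sym (trans (lookup-applyUpTo w N (fromℕ< p)) (cong w (toℕ-fromℕ< p)))

  selfSimilar⇒isMorphicBin : (π : Fin s → Bool) (c : ℕ → Bool) →
                             (∀ m → c (suc m) ≡ π (w m)) → IsMorphicBin c
  selfSimilar⇒isMorphicBin π c coding =
    s , σ , w 0 , w , π , σ-prolongable , unbounded , lookup-iterMorph , coding
    where
    unbounded : ∀ B → ∃ λ n → B < length (iterMorph σ n (w 0 ∷ []))
    unbounded B with iterMorph≡applyUpTo B
    ... | N , B<N , eq = B , subst (B <_) (sym (trans (cong length eq) (length-applyUpTo w N))) B<N

Range : (ℕ → ℕ) → ℕ → Set
Range f m = ∃ λ j → f j ≡ m

module StrictlyIncreasing {f : ℕ → ℕ} (f-< : ∀ n → f n < f (suc n)) where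

  mono-≤′ : ∀ {j k} → j ≤′ k → f j ≤ f k
  mono-≤′ (_≤′_.≤′-reflexive refl) = ≤-refl
  mono-≤′ (_≤′_.≤′-step j≤′k)      = ≤-trans (mono-≤′ j≤′k) (<⇒≤ (f-< _))

  mono-≤ : ∀ {j k} → j ≤ k → f j ≤ f k
  mono-≤ j≤k = mono-≤′ (≤⇒≤′ j≤k)

  ¬range-below : ∀ {m} → m < f 0 → ¬ Range f m
  ¬range-below m<f0 (j , refl) = <⇒≱ m<f0 (mono-≤ z≤n)

  ¬range-between : ∀ n {m} → f n < m → m < f (suc n) → ¬ Range f m
  ¬range-between n fn<m m<fn+1 (j , refl) with j ≤? n
  ... | yes j≤n = <⇒≱ fn<m (mono-≤ j≤n)
  ... | no  j≰n = <⇒≱ m<fn+1 (mono-≤ (≰⇒> j≰n))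

module HiccupMorphic (x′ y′ z′ : ℕ) where

  x y z : ℕ
  x = suc (suc x′)
  y = suc y′
  z = suc z′

  -- 0-indexed: a n = hiccup x y z (suc n), and terms n lists a n, …, a 0.
  a : ℕ → ℕ
  a n = proj₁ (hiccupAux x y z n)

  terms : ℕ → List ℕ
  terms n = proj₂ (hiccupAux x y z n)

  zeros : Bool → ℕ
  zeros true  = y′
  zeros false = z′

  hiccupAux-suc : ∀ n → a (suc n) ≡ a n + suc (zeros (does (suc (suc n) ∈? terms n)))
                        × terms (suc n) ≡ a (suc n) ∷ terms n
  hiccupAux-suc n with hiccupAux x y z n
  ... | _ , ts with suc (suc n) ∈? ts
  ... | yes _ = refl , refl
  ... | no  _ = refl , refl

  terms≡applyDownFrom : ∀ n → terms n ≡ applyDownFrom a (suc n)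
  terms≡applyDownFrom zero    = refl
  terms≡applyDownFrom (suc n) =
    trans (proj₂ (hiccupAux-suc n)) (cong (a (suc n) ∷_) (terms≡applyDownFrom n))

  a-< : ∀ n → a n < a (suc n)
  a-< n = subst (a n <_) (sym (proj₁ (hiccupAux-suc n))) (m<m+n (a n) (s≤s z≤n))

  open StrictlyIncreasing a-<

  2+n≤a : ∀ n → suc (suc n) ≤ a n
  2+n≤a zero    = s≤s (s≤s z≤n)
  2+n≤a (suc n) = ≤-trans (s≤s (2+n≤a n)) (a-< n)

  ∈terms⇒range : ∀ {m} n → m ∈ terms n → Range a m
  ∈terms⇒range n m∈ with ∈-applyDownFrom⁻ a (subst (_ ∈_) (terms≡applyDownFrom n) m∈)
  ... | j , _ , m≡aj = j , sym m≡aj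

  -- a j ≥ j + 2, so a term m is among the first m ∸ 1 terms.
  range⇒∈terms : ∀ {m} → Range a m → m ∈ terms (m ∸ 2)
  range⇒∈terms (j , refl) =
    subst (a j ∈_) (sym (terms≡applyDownFrom (a j ∸ 2))) (∈-applyDownFrom⁺ a (s≤s (∸-monoˡ-≤ 2 (2+n≤a j))))

  range? : ∀ m → Dec (Range a m)
  range? m = map′ (∈terms⇒range (m ∸ 2)) range⇒∈terms (m ∈? terms (m ∸ 2))

  isTerm : ℕ → Bool
  isTerm m = does (range? m)

  a-suc : ∀ n → a (suc n) ≡ suc (a n + zeros (isTerm (suc (suc n))))
  a-suc n = trans (proj₁ (hiccupAux-suc n)) (+-suc (a n) _)

  start : Fin 3
  start = fzero

  letter : Bool → Fin 3
  letter false = fsuc fzero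
  letter true  = fsuc (fsuc fzero)

  π : Fin 3 → Bool
  π fzero               = false
  π (fsuc fzero)        = false
  π (fsuc (fsuc fzero)) = true

  π-letter : ∀ b → π (letter b) ≡ b
  π-letter false = refl
  π-letter true  = refl

  block : ℕ → List (Fin 3)
  block g = replicate g (letter false) ∷ʳ letter true

  σ : Fin 3 → List (Fin 3)
  σ fzero               = start ∷ block x′
  σ (fsuc fzero)        = block (zeros false)
  σ (fsuc (fsuc fzero)) = block (zeros true)

  σ-letter : ∀ b → σ (letter b) ≡ block (zeros b)
  σ-letter false = refl
  σ-letter true  = refl

  w : ℕ → Fin 3
  w zero    = start
  w (suc i) = letter (isTerm (suc (suc i)))

  w-pos : ∀ {i} → 0 < i → w i ≡ letter (isTerm (suc i))
  w-pos {suc i} _ = refl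

  w-block : ∀ i g → 0 < i → (∀ t → t < g → ¬ Range a (suc (i + t))) → Range a (suc (i + g)) →
            applyUpTo (λ t → w (i + t)) (suc g) ≡ block g
  w-block i g 0<i inner end = applyUpTo≡replicate∷ʳ (λ t → w (i + t)) g
    (λ t t<g → trans (w-pos (position t)) (cong letter (dec-false (range? _) (inner t t<g))))
    (trans (w-pos (position g)) (cong letter (dec-true (range? _) end)))
    where
    position : ∀ t → 0 < i + t
    position t = <-≤-trans 0<i (m≤m+n i t)

  σ-prefix : ∀ n → concatMap σ (applyUpTo w (suc n)) ≡ applyUpTo w (a n)
  σ-prefix zero = trans (++-identityʳ (σ start)) (cong (start ∷_) (sym (w-block 1 x′ (s≤s z≤n)
    (λ t t<x′ → ¬range-below (s≤s (s≤s t<x′))) (0 , refl))))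
  σ-prefix (suc n) = begin
      concatMap σ (applyUpTo w (suc (suc n)))
    ≡⟨ cong (concatMap σ) (sym (applyUpTo-∷ʳ w (suc n))) ⟩
      concatMap σ (applyUpTo w (suc n) ∷ʳ w (suc n))
    ≡⟨ concatMap-++ σ (applyUpTo w (suc n)) (w (suc n) ∷ []) ⟩
      concatMap σ (applyUpTo w (suc n)) ++ (σ (w (suc n)) ++ [])
    ≡⟨ cong₂ _++_ (σ-prefix n) (trans (++-identityʳ (σ (w (suc n)))) (σ-letter b)) ⟩
      applyUpTo w (a n) ++ block g
    ≡⟨ cong (applyUpTo w (a n) ++_) (sym (w-block (a n) g 0<an inner end)) ⟩
      applyUpTo w (a n) ++ applyUpTo (λ t → w (a n + t)) (suc g)
    ≡⟨ sym (applyUpTo-++ w (a n) (suc g)) ⟩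
      applyUpTo w (a n + suc g)
    ≡⟨ cong (applyUpTo w) (trans (+-suc (a n) g) (sym (a-suc n))) ⟩
      applyUpTo w (a (suc n)) ∎
    where
    open ≡-Reasoning
    b : Bool
    b = isTerm (suc (suc n))
    g : ℕ
    g = zeros b
    0<an : 0 < a n
    0<an = ≤-trans (s≤s z≤n) (2+n≤a n)
    inner : ∀ t → t < g → ¬ Range a (suc (a n + t))
    inner t t<g = ¬range-between n (s≤s (m≤m+n (a n) t))
      (subst (suc (a n + t) <_) (sym (a-suc n)) (s≤s (+-monoʳ-< (a n) t<g)))
    end : Range a (suc (a n + g))
    end = suc n , a-suc n

  isTerm⇒range : ∀ m → isTerm m ≡ true → Range a m
  isTerm⇒range m isTerm≡true = invert (subst (Reflects (Range a m)) isTerm≡true (proof (range? m)))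

  isCharSeq : IsCharSeq (hiccup x y z) isTerm
  isCharSeq m _ = mk⇔
    (λ isTerm≡true → let j , aj≡m = isTerm⇒range m isTerm≡true in suc j , s≤s z≤n , aj≡m)
    (λ { (zero , () , _) ; (suc j , _ , aj≡m) → dec-true (range? m) (j , aj≡m) })

  coding : ∀ m → isTerm (suc m) ≡ π (w m)
  coding zero    = dec-false (range? 1) (¬range-below (s≤s (s≤s z≤n)))
  coding (suc m) = sym (π-letter _)

  hiccup-isMorphic : IsMorphicSeq (hiccup x y z)
  hiccup-isMorphic = isTerm , isCharSeq , selfSimilar⇒isMorphicBin σ w a σ-prefix 2+n≤a π isTerm coding

lemma5 : (x y z : ℕ) → 1 < x → 1 ≤ y → 1 ≤ z → y ≢ z →
    IsMorphicSeq (hiccup x y z)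
lemma5 (suc (suc x′)) (suc y′) (suc z′) (s≤s (s≤s z≤n)) (s≤s z≤n) (s≤s z≤n) _ =
  HiccupMorphic.hiccup-isMorphic x′ y′ z′
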